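{- For every $n\ge 2$, the $2$-polymatroid $S_n$ is an excluded minor for the class $\mathcal{P}_{U_{2,4}}$ of $2$-polymatroids whose natural matroids are binary. Here $S_n=(E,\rho)$ with $|E|=n$, $\rho(X)=|X|+1$ if $0<|X|<n$, and $\rho(X)=|X|$ if $X=\emptyset$ or $X=E$.
   Context: A (integer) polymatroid is a pair $(E,\rho)$ with $E$ finite and $\rho:2^E\to\mathbb{Z}$ satisfying $\rho(\emptyset)=0$, monotonicity, and submodularity; it is a $2$-polymatroid if $\rho(\{e\})\le 2$ for all $e$. Deletion $\rho_{\setminus X}$ is restriction to $E-X$; contraction $\rho_{/X}(Y)=\rho(Y\cup X)-\rho(X)$ on $E-X$; minors are $(\rho_{\setminus X})_{/Y}$ for disjoint $X,Y$. An excluded minor for a minor-closed class is a polymatroid not in the class whose proper minors all are. The natural matroid $M_\rho$: take pairwise disjoint sets $X_e$ with $|X_e|=\rho(\{e\})$, $X_A=\bigcup_{e\in A}X_e$, and let $M_\rho$ be the matroid on $X_E$ with rank $r(X)=\min\{\rho(A)+|X-X_A|:A\subseteq E\}$. -}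

module Defs where

open import Data.Nat using (ℕ; zero; suc; _+_; _∸_; _≤_; _<_; _⊓_)
open import Data.Nat.Properties using (_≟_)
open import Data.Bool using (Bool; true; false; if_then_else_; _∧_; not; _xor_)
open import Data.Fin using (Fin; zero; suc)
open import Data.Fin.Subset using (Subset; ⊥; ⊤; ⁅_⁆; _∪_; _∩_; _⊆_; ∣_∣; ∁; _∈_; _∉_; Nonempty)
open import Data.Vec using (Vec; []; _∷_; lookup)
open import Data.List using (List; []; _∷_; map; foldr; _++_)
open import Data.Product using (Σ; ∃; _×_; _,_)
open import Function.Bundles using (_⇔_)
open import Relation.Nullary using (¬_; yes; no)
open import Relation.Binary.PropositionalEquality using (_≡_)

-- Polymatroids on the ground set Fin n, with rank function on Subset n.
-- (Values in ℕ: with ρ ∅ = 0 and monotonicity, an integer-valued rank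
-- function is automatically non-negative.)

RankFn : ℕ → Set
RankFn n = Subset n → ℕ

record IsPolymatroid (n : ℕ) (ρ : RankFn n) : Set where
  field
    empty   : ρ ⊥ ≡ 0
    mono    : ∀ X Y → X ⊆ Y → ρ X ≤ ρ Y
    submod  : ∀ X Y → ρ (X ∪ Y) + ρ (X ∩ Y) ≤ ρ X + ρ Y

Is2Polymatroid : (n : ℕ) → RankFn n → Set
Is2Polymatroid n ρ = IsPolymatroid n ρ × (∀ e → ρ ⁅ e ⁆ ≤ 2)

sumFin : (m : ℕ) → (Fin m → ℕ) → ℕ
sumFin zero    f = 0
sumFin (suc m) f = f zero + sumFin m (λ i → f (suc i))

xorFin : (m : ℕ) → (Fin m → Bool) → Bool
xorFin zero    f = false
xorFin (suc m) f = f zero xor xorFin m (λ i → f (suc i))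

allSubsets : (n : ℕ) → List (Subset n)
allSubsets zero    = [] ∷ []
allSubsets (suc n) = map (false ∷_) (allSubsets n) ++ map (true ∷_) (allSubsets n)

-- The natural matroid M_ρ.  Its ground set X_E is the disjoint union of
-- the sets X_e = Fin (ρ {e}), i.e. the pairs (e , i) with i : Fin (ρ {e}).

NSub : (n : ℕ) → RankFn n → Set
NSub n ρ = (e : Fin n) → Fin (ρ ⁅ e ⁆) → Bool

ncount : (n : ℕ) (ρ : RankFn n) → NSub n ρ → ℕ
ncount n ρ X = sumFin n (λ e → sumFin (ρ ⁅ e ⁆) (λ i → if X e i then 1 else 0))

nminus : (n : ℕ) (ρ : RankFn n) → NSub n ρ → Subset n → NSub n ρ
nminus n ρ X A e i = X e i ∧ not (lookup A e)

-- r(X) = min { ρ(A) + |X - X_A| : A ⊆ E }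
-- (the fold starts from the value for A = ∅, which is itself in the list)
natRank : (n : ℕ) (ρ : RankFn n) → NSub n ρ → ℕ
natRank n ρ X =
  foldr _⊓_ (val ⊥) (map val (allSubsets n))
  where
  val : Subset n → ℕ
  val A = ρ A + ncount n ρ (nminus n ρ X A)

NatIndep : (n : ℕ) (ρ : RankFn n) → NSub n ρ → Set
NatIndep n ρ X = natRank n ρ X ≡ ncount n ρ X

-- Binary matroids: representable over GF(2) = Bool with xor.
-- A family of vectors v : X_E → GF(2)^m, and a set of elements is
-- linearly independent iff no nontrivial GF(2)-combination (i.e. no
-- nonempty subfamily sum) is the zero vector.

_⊆ₙ_ : {n : ℕ} {ρ : RankFn n} → NSub n ρ → NSub n ρ → Set
_⊆ₙ_ {n} {ρ} Y X = ∀ e i → Y e i ≡ true → X e i ≡ true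

Vectors : (n : ℕ) (ρ : RankFn n) (m : ℕ) → Set
Vectors n ρ m = (e : Fin n) → Fin (ρ ⁅ e ⁆) → Fin m → Bool

xorSum : (n : ℕ) (ρ : RankFn n) (m : ℕ) → Vectors n ρ m → NSub n ρ → Fin m → Bool
xorSum n ρ m v Y j = xorFin n (λ e → xorFin (ρ ⁅ e ⁆) (λ i → Y e i ∧ v e i j))

LinIndep : (n : ℕ) (ρ : RankFn n) (m : ℕ) → Vectors n ρ m → NSub n ρ → Set
LinIndep n ρ m v X =
  ∀ (Y : NSub n ρ) → _⊆ₙ_ {n} {ρ} Y X → 0 < ncount n ρ Y →
    ¬ (∀ j → xorSum n ρ m v Y j ≡ false)

NatBinary : (n : ℕ) → RankFn n → Set
NatBinary n ρ = Σ ℕ λ m → Σ (Vectors n ρ m) λ v →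
  ∀ (X : NSub n ρ) → NatIndep n ρ X ⇔ LinIndep n ρ m v X

InPU24 : (n : ℕ) → RankFn n → Set
InPU24 n ρ = Is2Polymatroid n ρ × NatBinary n ρ

-- Minors.  (ρ \ D) / C for disjoint D, C ⊆ E, with ground set E - (D ∪ C)
-- relabelled as Fin k via a bijection ι : Fin k → E - (D ∪ C).

image : {k n : ℕ} → (Fin k → Fin n) → Subset k → Subset n
image {zero}  ι []      = ⊥
image {suc k} ι (b ∷ Z) = (if b then ⁅ ι zero ⁆ else ⊥) ∪ image (λ j → ι (suc j)) Z

minorRank : {k n : ℕ} → RankFn n → Subset n → (Fin k → Fin n) → RankFn k
minorRank ρ C ι Z = ρ (image ι Z ∪ C) ∸ ρ C

IsLabelling : {k n : ℕ} → Subset n → (Fin k → Fin n) → Set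
IsLabelling {k} {n} R ι =
  (∀ j₁ j₂ → ι j₁ ≡ ι j₂ → j₁ ≡ j₂) × (∀ x → (x ∉ R) ⇔ (∃ λ j → ι j ≡ x))

ExcludedMinorPU24 : (n : ℕ) → RankFn n → Set
ExcludedMinorPU24 n ρ =
  IsPolymatroid n ρ × ¬ InPU24 n ρ ×
  (∀ (D C : Subset n) → (∀ x → x ∈ D → x ∉ C) → Nonempty (D ∪ C) →
     ∀ (k : ℕ) (ι : Fin k → Fin n) → IsLabelling (D ∪ C) ι →
       InPU24 k (minorRank ρ C ι))

S : (n : ℕ) → RankFn n
S n X with ∣ X ∣ ≟ 0 | ∣ X ∣ ≟ n
... | yes _ | _     = ∣ X ∣
... | no _  | yes _ = ∣ X ∣
... | no _  | no _  = suc ∣ X ∣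

-- S_n depends only on cardinality, through σ n, which is monotone and submodular on [0, n]; so S_n
-- is a polymatroid.  In its natural matroid every element is a block of two points; together with one
-- point of each of n - 2 blocks, any two of the four points of the remaining two blocks are independent
-- and no three are, a U_{2,4}-minor.  Deleting d and contracting c elements leaves the rank
-- Z ↦ σ n (|Z| + c) - σ n c, whose natural matroid is binary: k lines through a common point if c = 0,
-- free if c, d > 0, and a circuit (or loops) if d = 0 < c.

module Submission where

open import Defs
open import Algebra.Bundles using (CommutativeRing)
open import Data.Bool using (Bool; true; false; not; _∧_; _xor_; if_then_else_)
open import Data.Bool.Properties
  using (xor-∧-commutativeRing; xor-identityʳ; xor-same; ∧-distribˡ-xor; ∧-distribʳ-xor; ∧-zeroʳ; ∧-identityʳ; ¬-not)
open import Data.Empty using (⊥-elim)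
open import Data.Fin as Fin using (Fin; zero; suc; cast; fromℕ)
open import Data.Fin.Properties using (suc-injective; cast-is-id; cast-involutive; any?)
open import Data.Fin.Subset using (Subset; ⊥; ⊤; ⁅_⁆; _∪_; _∩_; ∁; ∣_∣; _∈_; _∉_; Nonempty)
open import Data.Fin.Subset.Properties
  using (∉⊥; ∈⊤; x∈⁅x⁆; x∈⁅y⁆⇒x≡y; x∈p∪q⁺; x∈p∪q⁻; x∈p∩q⁻; x∉p⇒x∈∁p; x∈∁p⇒x∉p; Empty-unique; ∪-identityˡ;
         ⊆-antisym; ∣p∣≤n; ∣⊥∣≡0; ∣⊤∣≡n; ∣⁅x⁆∣≡1; ∣∁p∣≡n∸∣p∣; p⊆q⇒∣p∣≤∣q∣; ∣p∩q∣≤∣p∣; ∣p∩q∣≤∣q∣; ∣p∣≤∣p∪q∣;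
         ∣q∣≤∣p∪q∣)
open import Data.List using (List; []; _∷_; map; foldr)
open import Data.List.Membership.Propositional using () renaming (_∈_ to _∈ₗ_)
open import Data.List.Membership.Propositional.Properties using (∈-map⁺; ∈-++⁺ˡ; ∈-++⁺ʳ)
open import Data.List.Relation.Unary.Any using (here; there)
open import Data.Nat using (ℕ; zero; suc; _+_; _∸_; _<_; _≤_; _⊓_; z≤n; s≤s; z<s; _≟_)
open import Data.Nat.Properties hiding (_≟_; suc-injective)
import Data.Nat.Properties as ℕ
open import Data.Product using (Σ; ∃; _×_; _,_; proj₁; proj₂)
open import Data.Sum using (inj₁; inj₂)
open import Data.Vec as Vec using ([]; _∷_; lookup; tabulate)
open import Data.Vec.Properties using (lookup-replicate; lookup∘tabulate)
open import Function.Base using (_∘_; id; case_of_)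
open import Function.Bundles using (_⇔_; mk⇔; Equivalence)
open import Function.Properties.Equivalence using () renaming (sym to ⇔-sym; trans to ⇔-trans)
open import Relation.Nullary using (¬_; yes; no; Dec; does)
open import Relation.Nullary.Decidable using (dec-true; dec-false)
open import Relation.Binary.PropositionalEquality

open import Algebra.Properties.CommutativeSemigroup +-commutativeSemigroup using (interchange)
open import Algebra.Properties.CommutativeSemigroup
  (CommutativeRing.+-commutativeSemigroup xor-∧-commutativeRing)
  using () renaming (interchange to xor-interchange)

sumFin-cong : ∀ m {f g : Fin m → ℕ} → (∀ i → f i ≡ g i) → sumFin m f ≡ sumFin m g
sumFin-cong zero    f≡g = refl
sumFin-cong (suc m) f≡g = cong₂ _+_ (f≡g zero) (sumFin-cong m (f≡g ∘ suc))

sumFin-mono : ∀ m {f g : Fin m → ℕ} → (∀ i → f i ≤ g i) → sumFin m f ≤ sumFin m g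
sumFin-mono zero    f≤g = z≤n
sumFin-mono (suc m) f≤g = +-mono-≤ (f≤g zero) (sumFin-mono m (f≤g ∘ suc))

sumFin-+ : ∀ m (f g : Fin m → ℕ) → sumFin m (λ i → f i + g i) ≡ sumFin m f + sumFin m g
sumFin-+ zero    f g = refl
sumFin-+ (suc m) f g = begin
  f zero + g zero + sumFin m (λ i → f (suc i) + g (suc i))
    ≡⟨ cong (f zero + g zero +_) (sumFin-+ m (f ∘ suc) (g ∘ suc)) ⟩
  f zero + g zero + (sumFin m (f ∘ suc) + sumFin m (g ∘ suc))
    ≡⟨ interchange (f zero) (g zero) _ _ ⟩
  sumFin (suc m) f + sumFin (suc m) g ∎
  where open ≡-Reasoning

sumFin-zero : ∀ m → sumFin m (λ _ → 0) ≡ 0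
sumFin-zero zero    = refl
sumFin-zero (suc m) = sumFin-zero m

sumFin-one : ∀ m → sumFin m (λ _ → 1) ≡ m
sumFin-one zero    = refl
sumFin-one (suc m) = cong suc (sumFin-one m)

term≤sumFin : ∀ m (f : Fin m → ℕ) i → f i ≤ sumFin m f
term≤sumFin (suc m) f zero    = m≤m+n _ _
term≤sumFin (suc m) f (suc i) = ≤-trans (term≤sumFin m (f ∘ suc) i) (m≤n+m _ _)

two-terms≤sumFin : ∀ m (f : Fin m → ℕ) {i j} → i ≢ j → 1 ≤ f i → 1 ≤ f j → 2 ≤ sumFin m f
two-terms≤sumFin (suc m) f {zero}  {zero}  i≢j _ _ = ⊥-elim (i≢j refl)
two-terms≤sumFin (suc m) f {zero}  {suc j} _   p q = +-mono-≤ p (≤-trans q (term≤sumFin m (f ∘ suc) j))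
two-terms≤sumFin (suc m) f {suc i} {zero}  _   p q = +-mono-≤ q (≤-trans p (term≤sumFin m (f ∘ suc) i))
two-terms≤sumFin (suc m) f {suc i} {suc j} i≢j p q =
  ≤-trans (two-terms≤sumFin m (f ∘ suc) (i≢j ∘ cong suc) p q) (m≤n+m _ _)

sumFin-<⁺ : ∀ m {f g : Fin m → ℕ} → (∀ i → f i ≤ g i) → ∀ i → f i < g i → sumFin m f < sumFin m g
sumFin-<⁺ (suc m) f≤g zero    fi<gi = +-mono-<-≤ fi<gi (sumFin-mono m (f≤g ∘ suc))
sumFin-<⁺ (suc m) f≤g (suc i) fi<gi = +-mono-≤-< (f≤g zero) (sumFin-<⁺ m (f≤g ∘ suc) i fi<gi)

sumFin-positive : ∀ m (f : Fin m → ℕ) → 0 < sumFin m f → ∃ λ i → 0 < f i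
sumFin-positive (suc m) f pos with f zero in eq
... | suc _ = zero , subst (0 <_) (sym eq) z<s
... | zero  with sumFin-positive m (f ∘ suc) pos
...   | i , p = suc i , p

sumFin-reindex : ∀ {a b} (a≡b : a ≡ b) (g : Fin b → ℕ) → sumFin a (g ∘ cast a≡b) ≡ sumFin b g
sumFin-reindex {a} refl g = sumFin-cong a (cong g ∘ cast-is-id refl)

xorFin-cong : ∀ m {f g : Fin m → Bool} → (∀ i → f i ≡ g i) → xorFin m f ≡ xorFin m g
xorFin-cong zero    f≡g = refl
xorFin-cong (suc m) f≡g = cong₂ _xor_ (f≡g zero) (xorFin-cong m (f≡g ∘ suc))

xorFin-xor : ∀ m (f g : Fin m → Bool) → xorFin m (λ i → f i xor g i) ≡ xorFin m f xor xorFin m g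
xorFin-xor zero    f g = refl
xorFin-xor (suc m) f g =
  trans (cong ((f zero xor g zero) xor_) (xorFin-xor m (f ∘ suc) (g ∘ suc)))
        (xor-interchange (f zero) (g zero) _ _)

xorFin-false : ∀ m → xorFin m (λ _ → false) ≡ false
xorFin-false zero    = refl
xorFin-false (suc m) = xorFin-false m

xorFin-single : ∀ m (f : Fin m → Bool) i → (∀ j → j ≢ i → f j ≡ false) → xorFin m f ≡ f i
xorFin-single (suc m) f zero f≡false = begin
  f zero xor xorFin m (f ∘ suc)     ≡⟨ cong (f zero xor_) (xorFin-cong m (λ j → f≡false (suc j) λ ())) ⟩
  f zero xor xorFin m (λ _ → false) ≡⟨ cong (f zero xor_) (xorFin-false m) ⟩
  f zero xor false                  ≡⟨ xor-identityʳ (f zero) ⟩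
  f zero                            ∎
  where open ≡-Reasoning
xorFin-single (suc m) f (suc i) f≡false rewrite f≡false zero (λ ()) =
  xorFin-single m (f ∘ suc) i (λ j j≢i → f≡false (suc j) (j≢i ∘ suc-injective))

xorFin-reindex : ∀ {a b} (a≡b : a ≡ b) (g : Fin b → Bool) → xorFin a (g ∘ cast a≡b) ≡ xorFin b g
xorFin-reindex {a} refl g = xorFin-cong a (cong g ∘ cast-is-id refl)

xor≡false⇒≡ : ∀ {a b} → a xor b ≡ false → a ≡ b
xor≡false⇒≡ {true}  {true}  _ = refl
xor≡false⇒≡ {false} {false} _ = refl

𝟙 : Bool → ℕ
𝟙 b = if b then 1 else 0

𝟙≤1 : ∀ b → 𝟙 b ≤ 1
𝟙≤1 true  = ≤-refl
𝟙≤1 false = z≤n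

𝟙-positive : ∀ {b} → 1 ≤ 𝟙 b → b ≡ true
𝟙-positive {true} _ = refl

sumFin𝟙≥2 : ∀ m (f : Fin m → Bool) → 2 ≤ sumFin m (𝟙 ∘ f) →
  ∃ λ i → ∃ λ j → i ≢ j × f i ≡ true × f j ≡ true
sumFin𝟙≥2 (suc m) f 2≤Σ with f zero in eq
... | true  with sumFin-positive m (𝟙 ∘ f ∘ suc) (≤-pred 2≤Σ)
...   | j , p = zero , suc j , (λ ()) , eq , 𝟙-positive p
sumFin𝟙≥2 (suc m) f 2≤Σ | false with sumFin𝟙≥2 m (f ∘ suc) 2≤Σ
...   | i , j , i≢j , p , q = suc i , suc j , i≢j ∘ suc-injective , p , q

∣p∣≡sumFin : ∀ {n} (p : Subset n) → ∣ p ∣ ≡ sumFin n (𝟙 ∘ lookup p)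
∣p∣≡sumFin []          = refl
∣p∣≡sumFin (true ∷ p)  = cong suc (∣p∣≡sumFin p)
∣p∣≡sumFin (false ∷ p) = ∣p∣≡sumFin p

∣p∪q∣+∣p∩q∣≡∣p∣+∣q∣ : ∀ {n} (p q : Subset n) → ∣ p ∪ q ∣ + ∣ p ∩ q ∣ ≡ ∣ p ∣ + ∣ q ∣
∣p∪q∣+∣p∩q∣≡∣p∣+∣q∣ []          []          = refl
∣p∪q∣+∣p∩q∣≡∣p∣+∣q∣ (false ∷ p) (false ∷ q) = ∣p∪q∣+∣p∩q∣≡∣p∣+∣q∣ p q
∣p∪q∣+∣p∩q∣≡∣p∣+∣q∣ (true ∷ p)  (false ∷ q) = cong suc (∣p∪q∣+∣p∩q∣≡∣p∣+∣q∣ p q)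
∣p∪q∣+∣p∩q∣≡∣p∣+∣q∣ (false ∷ p) (true ∷ q)  =
  trans (cong suc (∣p∪q∣+∣p∩q∣≡∣p∣+∣q∣ p q)) (sym (+-suc ∣ p ∣ ∣ q ∣))
∣p∪q∣+∣p∩q∣≡∣p∣+∣q∣ (true ∷ p)  (true ∷ q)  =
  cong suc (trans (+-suc ∣ p ∪ q ∣ _) (trans (cong suc (∣p∪q∣+∣p∩q∣≡∣p∣+∣q∣ p q)) (sym (+-suc ∣ p ∣ ∣ q ∣))))

∣p∪q∣≡∣p∣+∣q∣ : ∀ {n} {p q : Subset n} → (∀ x → x ∈ p → x ∉ q) → ∣ p ∪ q ∣ ≡ ∣ p ∣ + ∣ q ∣
∣p∪q∣≡∣p∣+∣q∣ {n} {p} {q} disjoint = begin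
  ∣ p ∪ q ∣              ≡⟨ sym (+-identityʳ _) ⟩
  ∣ p ∪ q ∣ + 0          ≡⟨ cong (∣ p ∪ q ∣ +_) (sym (trans (cong ∣_∣ p∩q≡⊥) (∣⊥∣≡0 n))) ⟩
  ∣ p ∪ q ∣ + ∣ p ∩ q ∣  ≡⟨ ∣p∪q∣+∣p∩q∣≡∣p∣+∣q∣ p q ⟩
  ∣ p ∣ + ∣ q ∣          ∎
  where
  open ≡-Reasoning
  p∩q≡⊥ : p ∩ q ≡ ⊥
  p∩q≡⊥ = Empty-unique λ (x , x∈p∩q) → let (x∈p , x∈q) = x∈p∩q⁻ p q x∈p∩q in disjoint x x∈p x∈q

foldr-⊓-greatest : ∀ {A : Set} (val : A → ℕ) {c b} (xs : List A) →
  c ≤ b → (∀ x → c ≤ val x) → c ≤ foldr _⊓_ b (map val xs)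
foldr-⊓-greatest val []       c≤b c≤val = c≤b
foldr-⊓-greatest val (x ∷ xs) c≤b c≤val = ⊓-glb (c≤val x) (foldr-⊓-greatest val xs c≤b c≤val)

foldr-⊓≤member : ∀ {A : Set} (val : A → ℕ) b {xs : List A} {x} → x ∈ₗ xs → foldr _⊓_ b (map val xs) ≤ val x
foldr-⊓≤member val b (here refl) = m⊓n≤m _ _
foldr-⊓≤member val b (there x∈xs) = ≤-trans (m⊓n≤n _ _) (foldr-⊓≤member val b x∈xs)

foldr-⊓≤init : ∀ {A : Set} (val : A → ℕ) b (xs : List A) → foldr _⊓_ b (map val xs) ≤ b
foldr-⊓≤init val b []       = ≤-refl
foldr-⊓≤init val b (x ∷ xs) = ≤-trans (m⊓n≤n _ _) (foldr-⊓≤init val b xs)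

∈-allSubsets : ∀ {n} (A : Subset n) → A ∈ₗ allSubsets n
∈-allSubsets []          = here refl
∈-allSubsets (false ∷ A) = ∈-++⁺ˡ (∈-map⁺ (false ∷_) (∈-allSubsets A))
∈-allSubsets (true ∷ A)  = ∈-++⁺ʳ _ (∈-map⁺ (true ∷_) (∈-allSubsets A))

-- The natural matroid, for an arbitrary family s of block sizes.  Keeping s apart from the
-- rank function lets a block size ρ ⁅ e ⁆ be replaced by a number it is only provably equal to.

module Blocks {n : ℕ} (s : Fin n → ℕ) where

  PointSet : Set
  PointSet = (e : Fin n) → Fin (s e) → Bool

  size : PointSet → ℕ
  size X = sumFin n (λ e → sumFin (s e) (𝟙 ∘ X e))

  _∖_ : PointSet → Subset n → PointSet
  (X ∖ A) e i = X e i ∧ not (lookup A e)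

  _⊆ₚ_ : PointSet → PointSet → Set
  Y ⊆ₚ X = ∀ e i → Y e i ≡ true → X e i ≡ true

  -- X is independent iff its rank min_A (r A + |X - X_A|) in the natural matroid is |X|.
  Independent : (Subset n → ℕ) → PointSet → Set
  Independent r X = ∀ A → size X ≤ r A + size (X ∖ A)

  Representation : ℕ → Set
  Representation m = (e : Fin n) → Fin (s e) → Fin m → Bool

  vsum : ∀ {m} → Representation m → PointSet → Fin m → Bool
  vsum v Y j = xorFin n (λ e → xorFin (s e) (λ i → Y e i ∧ v e i j))

  ZeroSum : ∀ {m} → Representation m → PointSet → Set
  ZeroSum v Y = ∀ j → vsum v Y j ≡ false

  LinearlyIndependent : ∀ {m} → Representation m → PointSet → Set
  LinearlyIndependent v X = ∀ Y → Y ⊆ₚ X → 0 < size Y → ¬ ZeroSum v Y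

  BinaryNatural : (Subset n → ℕ) → Set
  BinaryNatural r = Σ ℕ λ m → Σ (Representation m) λ v →
    ∀ X → Independent r X ⇔ LinearlyIndependent v X

  size-cong : ∀ {X Y} → (∀ e i → X e i ≡ Y e i) → size X ≡ size Y
  size-cong X≡Y = sumFin-cong n (λ e → sumFin-cong (s e) (cong 𝟙 ∘ X≡Y e))

  size-∖⊥ : ∀ X → size (X ∖ ⊥) ≡ size X
  size-∖⊥ X = size-cong (λ e i → trans (cong (λ b → X e i ∧ not b) (lookup-replicate e false)) (∧-identityʳ _))

  size-∖⊤ : ∀ X → size (X ∖ ⊤) ≡ 0
  size-∖⊤ X = trans (size-cong (λ e i → trans (cong (λ b → X e i ∧ not b) (lookup-replicate e true)) (∧-zeroʳ _)))
                    (trans (sumFin-cong n (λ e → sumFin-zero (s e))) (sumFin-zero n))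

  independent⇒size≤ : ∀ {r X} → Independent r X → size X ≤ r ⊤
  independent⇒size≤ {r} {X} ind = subst (size X ≤_) (trans (cong (r ⊤ +_) (size-∖⊤ X)) (+-identityʳ _)) (ind ⊤)

  ⊆-xor : ∀ {Y Z X} → Y ⊆ₚ X → Z ⊆ₚ X → (λ e i → Y e i xor Z e i) ⊆ₚ X
  ⊆-xor {Y} {Z} Y⊆X Z⊆X e i with Y e i | Z e i | Y⊆X e i | Z⊆X e i
  ... | true  | _ | Yei⇒ | _    = λ _ → Yei⇒ refl
  ... | false | _ | _    | Zei⇒ = Zei⇒

  vsum-xor : ∀ {m} (v : Representation m) Y Z j →
    vsum v (λ e i → Y e i xor Z e i) j ≡ vsum v Y j xor vsum v Z j
  vsum-xor v Y Z j = begin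
    xorFin n (λ e → xorFin (s e) (λ i → (Y e i xor Z e i) ∧ v e i j))
      ≡⟨ xorFin-cong n (λ e → xorFin-cong (s e) (λ i → ∧-distribʳ-xor (v e i j) (Y e i) (Z e i))) ⟩
    xorFin n (λ e → xorFin (s e) (λ i → (Y e i ∧ v e i j) xor (Z e i ∧ v e i j)))
      ≡⟨ xorFin-cong n (λ e → xorFin-xor (s e) _ _) ⟩
    xorFin n (λ e → xorFin (s e) (λ i → Y e i ∧ v e i j) xor xorFin (s e) (λ i → Z e i ∧ v e i j))
      ≡⟨ xorFin-xor n _ _ ⟩
    vsum v Y j xor vsum v Z j ∎
    where open ≡-Reasoning

open Blocks

natIndep⇔independent : ∀ {n} (ρ : RankFn n) → ρ ⊥ ≡ 0 → ∀ X →
  NatIndep n ρ X ⇔ Independent (λ e → ρ ⁅ e ⁆) ρ X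
natIndep⇔independent {n} ρ ρ⊥≡0 X = mk⇔
  (λ r≡size A → subst (_≤ val A) r≡size (foldr-⊓≤member val (val ⊥) (∈-allSubsets A)))
  (λ ind → ≤-antisym (≤-trans (foldr-⊓≤init val (val ⊥) (allSubsets n)) (≤-reflexive val⊥≡size))
                     (foldr-⊓-greatest val (allSubsets n) (≤-reflexive (sym val⊥≡size)) ind))
  where
  s = λ e → ρ ⁅ e ⁆
  val : Subset n → ℕ
  val A = ρ A + size s (_∖_ s X A)
  val⊥≡size : val ⊥ ≡ size s X
  val⊥≡size = cong₂ _+_ ρ⊥≡0 (size-∖⊥ s X)

natBinary⇔binaryNatural : ∀ {n} (ρ : RankFn n) → ρ ⊥ ≡ 0 →
  NatBinary n ρ ⇔ BinaryNatural (λ e → ρ ⁅ e ⁆) ρ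
natBinary⇔binaryNatural ρ ρ⊥≡0 = mk⇔
  (λ (m , v , nat⇔lin) → m , v , λ X → ⇔-trans (⇔-sym (natIndep⇔independent ρ ρ⊥≡0 X)) (nat⇔lin X))
  (λ (m , v , ind⇔lin) → m , v , λ X → ⇔-trans (natIndep⇔independent ρ ρ⊥≡0 X) (ind⇔lin X))

binaryNatural-resize : ∀ {n} {s t : Fin n → ℕ} (r : Subset n → ℕ) →
  (∀ e → s e ≡ t e) → BinaryNatural t r → BinaryNatural s r
binaryNatural-resize {n} {s} {t} r s≡t (m , v , ind⇔lin) =
  m , v′ , λ X → ⇔-trans (⇔-sym (independent-up X)) (⇔-trans (ind⇔lin (up X)) (linIndep-up X))
  where
  v′ : Representation s m
  v′ e = v e ∘ cast (s≡t e)
  up : PointSet s → PointSet t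
  up X e = X e ∘ cast (sym (s≡t e))
  down : PointSet t → PointSet s
  down Y e = Y e ∘ cast (s≡t e)
  size-up : ∀ X → size t (up X) ≡ size s X
  size-up X = sumFin-cong n (λ e → sumFin-reindex (sym (s≡t e)) (𝟙 ∘ X e))
  size-down : ∀ Y → size s (down Y) ≡ size t Y
  size-down Y = sumFin-cong n (λ e → sumFin-reindex (s≡t e) (𝟙 ∘ Y e))
  vsum-up : ∀ Y j → vsum t v (up Y) j ≡ vsum s v′ Y j
  vsum-up Y j = xorFin-cong n (λ e → trans
    (xorFin-cong (t e) (λ i → cong (λ k → Y e (cast (sym (s≡t e)) i) ∧ v e k j)
      (sym (cast-involutive (s≡t e) (sym (s≡t e)) i))))
    (xorFin-reindex (sym (s≡t e)) (λ i → Y e i ∧ v′ e i j)))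
  vsum-down : ∀ Y j → vsum s v′ (down Y) j ≡ vsum t v Y j
  vsum-down Y j = xorFin-cong n (λ e → xorFin-reindex (s≡t e) (λ i → Y e i ∧ v e i j))
  independent-up : ∀ X → Independent t r (up X) ⇔ Independent s r X
  independent-up X = mk⇔
    (λ ind A → subst₂ (λ a b → a ≤ r A + b) (size-up X) (size-up (_∖_ s X A)) (ind A))
    (λ ind A → subst₂ (λ a b → a ≤ r A + b) (sym (size-up X)) (sym (size-up (_∖_ s X A))) (ind A))
  linIndep-up : ∀ X → LinearlyIndependent t v (up X) ⇔ LinearlyIndependent s v′ X
  linIndep-up X = mk⇔
    (λ lin Y Y⊆X pos sum≡0 → lin (up Y) (λ e i → Y⊆X e _)
       (subst (0 <_) (sym (size-up Y)) pos) (λ j → trans (vsum-up Y j) (sum≡0 j)))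
    (λ lin Y Y⊆upX pos sum≡0 → lin (down Y)
       (λ e i Yi → subst (λ k → X e k ≡ true) (cast-involutive (sym (s≡t e)) (s≡t e) i) (Y⊆upX e _ Yi))
       (subst (0 <_) (sym (size-down Y)) pos) (λ j → trans (vsum-down Y j) (sum≡0 j)))

binaryNatural-noPoints : ∀ {n} {s : Fin n → ℕ} (r : Subset n → ℕ) → (∀ e → s e ≡ 0) → BinaryNatural s r
binaryNatural-noPoints {n} r s≡0 = binaryNatural-resize r s≡0
  (0 , (λ e ()) , λ X → mk⇔ (λ _ Y _ pos _ → <-irrefl refl (≤-trans pos (≤-reflexive (size≡0 Y))))
                            (λ _ A → ≤-trans (≤-reflexive (size≡0 X)) z≤n))
  where
  size≡0 : ∀ Y → size {n} (λ _ → 0) Y ≡ 0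
  size≡0 Y = sumFin-zero n

module _ {n : ℕ} {s : Fin n → ℕ} where

  size≤sumFin+size∖ : ∀ (X : PointSet s) A (w : Fin n → ℕ) →
    (∀ e → sumFin (s e) (𝟙 ∘ X e) ≤ w e + sumFin (s e) (𝟙 ∘ _∖_ s X A e)) →
    size s X ≤ sumFin n w + size s (_∖_ s X A)
  size≤sumFin+size∖ X A w pointwise = ≤-trans (sumFin-mono n pointwise) (≤-reflexive (sumFin-+ n w _))

  size-positive : ∀ (Y : PointSet s) → 0 < size s Y → ∃ λ e → ∃ λ i → Y e i ≡ true
  size-positive Y pos with sumFin-positive n _ pos
  ... | e , p with sumFin-positive (s e) _ p
  ...   | i , q = e , i , 𝟙-positive q

  size-positive⁺ : ∀ (Y : PointSet s) e i → Y e i ≡ true → 0 < size s Y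
  size-positive⁺ Y e i Yei = ≤-trans (≤-trans (subst (λ b → 0 < 𝟙 b) (sym Yei) z<s)
    (term≤sumFin (s e) (𝟙 ∘ Y e) i)) (term≤sumFin n (λ e → sumFin (s e) (𝟙 ∘ Y e)) e)

one : ∀ {k} → Fin k → ℕ
one _ = 1

size-one : ∀ {k} (X : PointSet {k} one) → size one X ≡ sumFin k (λ e → 𝟙 (X e zero))
size-one {k} X = sumFin-cong k (λ e → +-identityʳ _)

vsum-one : ∀ {k m} (v : Representation {k} one m) Y j →
  vsum one v Y j ≡ xorFin k (λ e → Y e zero ∧ v e zero j)
vsum-one {k} v Y j = xorFin-cong k (λ e → xor-identityʳ _)

independent-card : ∀ {k} (X : PointSet {k} one) → Independent one ∣_∣ X
independent-card {k} X A = subst (λ c → size one X ≤ c + size one (_∖_ one X A)) (sym (∣p∣≡sumFin A))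
  (size≤sumFin+size∖ X A (𝟙 ∘ lookup A) (λ e → pointwise (X e zero) (lookup A e)))
  where
  pointwise : ∀ x a → 𝟙 x + 0 ≤ 𝟙 a + (𝟙 (x ∧ not a) + 0)
  pointwise true  true  = s≤s z≤n
  pointwise true  false = ≤-refl
  pointwise false a     = z≤n

δ : ∀ {k} → Fin k → Fin k → Bool
δ i j = does (i Fin.≟ j)

δ-refl : ∀ {k} (i : Fin k) → δ i i ≡ true
δ-refl i = dec-true (i Fin.≟ i) refl

δ-≢ : ∀ {k} {i j : Fin k} → i ≢ j → δ i j ≡ false
δ-≢ {i = i} {j} i≢j = dec-false (i Fin.≟ j) i≢j

δ≡true : ∀ {k} {i j : Fin k} → δ i j ≡ true → i ≡ j
δ≡true {i = i} {j} δij with i Fin.≟ j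
... | yes i≡j = i≡j

xorFin-δ : ∀ k (b : Fin k → Bool) j → xorFin k (λ e → b e ∧ δ e j) ≡ b j
xorFin-δ k b j = trans
  (xorFin-single k _ j (λ e e≢j → trans (cong (b e ∧_) (δ-≢ e≢j)) (∧-zeroʳ (b e))))
  (trans (cong (b j ∧_) (δ-refl j)) (∧-identityʳ (b j)))

binaryNatural-free : ∀ {k} (r : Subset k → ℕ) → (∀ Z → r Z ≡ ∣ Z ∣) → BinaryNatural one r
binaryNatural-free {k} r r≡card = k , v , λ X → mk⇔ (λ _ → linIndep X) (λ _ → independent X)
  where
  v : Representation one k
  v e _ = δ e
  vsum-v : ∀ Y j → vsum one v Y j ≡ Y j zero
  vsum-v Y j = trans (vsum-one v Y j) (xorFin-δ k (λ e → Y e zero) j)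
  linIndep : ∀ X → LinearlyIndependent one v X
  linIndep X Y _ pos sum≡0 with size-positive Y pos
  ... | e , zero , Ye = case trans (sym Ye) (trans (sym (vsum-v Y e)) (sum≡0 e)) of λ ()
  independent : ∀ X → Independent one r X
  independent X A = subst (λ c → size one X ≤ c + size one (_∖_ one X A)) (sym (r≡card A)) (independent-card X A)

Misses : ∀ {k} → PointSet {k} one → Set
Misses X = ∃ λ e → X e zero ≡ false

misses? : ∀ {k} (X : PointSet {k} one) → Dec (Misses X)
misses? X = any? (λ e → X e zero Data.Bool.≟ false)

¬misses⇒present : ∀ {k} (X : PointSet {k} one) → ¬ Misses X → ∀ e → X e zero ≡ true
¬misses⇒present X full e with X e zero in eq
... | true  = refl
... | false = ⊥-elim (full (e , eq))

¬misses⇒size≡ : ∀ {k} (X : PointSet {k} one) → ¬ Misses X → size one X ≡ k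
¬misses⇒size≡ {k} X full =
  trans (size-one X) (trans (sumFin-cong k (cong 𝟙 ∘ ¬misses⇒present X full)) (sumFin-one k))

misses⇒size< : ∀ {k} (X : PointSet {k} one) → Misses X → size one X < k
misses⇒size< {k} X (e , Xe≡false) = subst₂ _<_ (sym (size-one X)) (sumFin-one k)
  (sumFin-<⁺ k (λ e → 𝟙≤1 (X e zero)) e (subst (λ b → 𝟙 b < 1) (sym Xe≡false) z<s))

-- Point e is the vector u_e + u_last, so that all k points sum to zero.
circuit : ∀ {k₀} → Representation {suc k₀} one (suc k₀)
circuit {k₀} e _ j = δ e j xor δ e (fromℕ k₀)

vsum-circuit : ∀ {k₀} (Y : PointSet {suc k₀} one) j → vsum one circuit Y j ≡ Y j zero xor Y (fromℕ k₀) zero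
vsum-circuit {k₀} Y j = begin
  vsum one circuit Y j
    ≡⟨ vsum-one circuit Y j ⟩
  xorFin k (λ e → Y e zero ∧ (δ e j xor δ e last))
    ≡⟨ xorFin-cong k (λ e → ∧-distribˡ-xor (Y e zero) (δ e j) (δ e last)) ⟩
  xorFin k (λ e → (Y e zero ∧ δ e j) xor (Y e zero ∧ δ e last))
    ≡⟨ xorFin-xor k (λ e → Y e zero ∧ δ e j) (λ e → Y e zero ∧ δ e last) ⟩
  xorFin k (λ e → Y e zero ∧ δ e j) xor xorFin k (λ e → Y e zero ∧ δ e last)
    ≡⟨ cong₂ _xor_ (xorFin-δ k (λ e → Y e zero) j) (xorFin-δ k (λ e → Y e zero) last) ⟩
  Y j zero xor Y last zero ∎
  where
  open ≡-Reasoning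
  k = suc k₀
  last = fromℕ k₀

linIndep-circuit⇒misses : ∀ {k₀} (X : PointSet {suc k₀} one) → LinearlyIndependent one circuit X → Misses X
linIndep-circuit⇒misses {k₀} X lin with misses? X
... | yes misses = misses
... | no full = ⊥-elim (lin X (λ _ _ → id) (subst (0 <_) (sym (¬misses⇒size≡ X full)) z<s)
                  (λ j → trans (vsum-circuit X j) (cong₂ _xor_ (present j) (present (fromℕ k₀)))))
  where present = ¬misses⇒present X full

misses⇒linIndep-circuit : ∀ {k₀} (X : PointSet {suc k₀} one) → Misses X → LinearlyIndependent one circuit X
misses⇒linIndep-circuit {k₀} X (e₀ , Xe₀≡false) Y Y⊆X pos sum≡0 with size-positive Y pos
... | e , zero , Ye = case trans (sym (Y⊆X e₀ zero Ye₀)) Xe₀≡false of λ ()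
  where
  Y≡Ylast : ∀ j → Y j zero ≡ Y (fromℕ k₀) zero
  Y≡Ylast j = xor≡false⇒≡ (trans (sym (vsum-circuit Y j)) (sum≡0 j))
  Ye₀ : Y e₀ zero ≡ true
  Ye₀ = trans (Y≡Ylast e₀) (trans (sym (Y≡Ylast e)) Ye)

module _ {k₀ : ℕ} (r : Subset (suc k₀) → ℕ) (r-proper : ∀ Z → ∣ Z ∣ ≢ suc k₀ → r Z ≡ ∣ Z ∣)
         (r-full : ∀ Z → ∣ Z ∣ ≡ suc k₀ → r Z ≡ k₀) (X : PointSet {suc k₀} one) where

  independent⇒misses : Independent one r X → Misses X
  independent⇒misses ind with misses? X
  ... | yes misses = misses
  ... | no full = ⊥-elim (<-irrefl refl (begin-strict
    k₀          <⟨ n<1+n k₀ ⟩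
    suc k₀      ≡⟨ sym (¬misses⇒size≡ X full) ⟩
    size one X  ≤⟨ independent⇒size≤ one {r} {X} ind ⟩
    r ⊤         ≡⟨ r-full ⊤ (∣⊤∣≡n (suc k₀)) ⟩
    k₀          ∎))
    where open ≤-Reasoning

  misses⇒independent : Misses X → Independent one r X
  misses⇒independent misses A with ∣ A ∣ ≟ suc k₀
  ... | yes ∣A∣≡k =
    ≤-trans (≤-pred (misses⇒size< X misses)) (≤-trans (≤-reflexive (sym (r-full A ∣A∣≡k))) (m≤m+n _ _))
  ... | no  ∣A∣≢k =
    subst (λ c → size one X ≤ c + size one (_∖_ one X A)) (sym (r-proper A ∣A∣≢k)) (independent-card X A)

binaryNatural-circuit : ∀ {k₀} (r : Subset (suc k₀) → ℕ) →
  (∀ Z → ∣ Z ∣ ≢ suc k₀ → r Z ≡ ∣ Z ∣) → (∀ Z → ∣ Z ∣ ≡ suc k₀ → r Z ≡ k₀) → BinaryNatural one r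
binaryNatural-circuit {k₀} r r-proper r-full = suc k₀ , circuit , λ X → mk⇔
  (misses⇒linIndep-circuit X ∘ independent⇒misses r r-proper r-full X)
  (misses⇒independent r r-proper r-full X ∘ linIndep-circuit⇒misses X)

two : ∀ {k} → Fin k → ℕ
two _ = 2

full : ∀ {k} → PointSet {k} two → Fin k → Bool
full X e = X e zero ∧ X e (suc zero)

fullBlocks : ∀ {k} → PointSet {k} two → ℕ
fullBlocks {k} X = sumFin k (𝟙 ∘ full X)

module _ {k : ℕ} (r : Subset k → ℕ) (r-empty : ∀ Z → ∣ Z ∣ ≡ 0 → r Z ≡ 0)
         (r-nonempty : ∀ Z → ∣ Z ∣ ≢ 0 → r Z ≡ suc ∣ Z ∣) (X : PointSet {k} two) where

  -- With A the set of full blocks, |X| = 2 |A| + |X - X_A| while r A = |A| + 1.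
  independent⇒fullBlocks≤1 : Independent two r X → fullBlocks X ≤ 1
  independent⇒fullBlocks≤1 ind with fullBlocks X ≟ 0
  ... | yes F≡0 = ≤-trans (≤-reflexive F≡0) z≤n
  ... | no  F≢0 = +-cancelˡ-≤ F F 1 (≤-trans (+-cancelʳ-≤ (size two (_∖_ two X A)) (F + F) (suc F) 2F≤1+F)
                                             (≤-reflexive (+-comm 1 F)))
    where
    F = fullBlocks X
    A : Subset k
    A = tabulate (full X)
    ∣A∣≡F : ∣ A ∣ ≡ F
    ∣A∣≡F = trans (∣p∣≡sumFin A) (sumFin-cong k (cong 𝟙 ∘ lookup∘tabulate (full X)))
    pointwise : ∀ x₀ x₁ → 𝟙 x₀ + (𝟙 x₁ + 0) ≡
      (𝟙 (x₀ ∧ x₁) + 𝟙 (x₀ ∧ x₁)) + (𝟙 (x₀ ∧ not (x₀ ∧ x₁)) + (𝟙 (x₁ ∧ not (x₀ ∧ x₁)) + 0))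
    pointwise true  true  = refl
    pointwise true  false = refl
    pointwise false true  = refl
    pointwise false false = refl
    size≡ : size two X ≡ (F + F) + size two (_∖_ two X A)
    size≡ = begin
      size two X
        ≡⟨ sumFin-cong k (λ e → trans (pointwise (X e zero) (X e (suc zero)))
             (cong (λ a → (𝟙 (full X e) + 𝟙 (full X e)) + (𝟙 (X e zero ∧ not a) + (𝟙 (X e (suc zero) ∧ not a) + 0)))
                   (sym (lookup∘tabulate (full X) e)))) ⟩
      sumFin k (λ e → (𝟙 (full X e) + 𝟙 (full X e)) + sumFin 2 (𝟙 ∘ _∖_ two X A e))
        ≡⟨ sumFin-+ k _ _ ⟩
      sumFin k (λ e → 𝟙 (full X e) + 𝟙 (full X e)) + size two (_∖_ two X A)
        ≡⟨ cong (_+ size two (_∖_ two X A)) (sumFin-+ k _ _) ⟩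
      (F + F) + size two (_∖_ two X A) ∎
      where open ≡-Reasoning
    2F≤1+F : (F + F) + size two (_∖_ two X A) ≤ suc F + size two (_∖_ two X A)
    2F≤1+F = subst₂ _≤_ size≡ (cong (_+ size two (_∖_ two X A)) (trans (r-nonempty A (F≢0 ∘ trans (sym ∣A∣≡F)))
                                                                      (cong suc ∣A∣≡F)))
                     (ind A)

  fullBlocks≤1⇒independent : fullBlocks X ≤ 1 → Independent two r X
  fullBlocks≤1⇒independent F≤1 A =
    ≤-trans (size≤sumFin+size∖ X A w (λ e → pointwise (X e zero) (X e (suc zero)) (lookup A e)))
            (+-monoˡ-≤ _ (subst (_≤ r A) (sym Σw≡) ∣A∣+FA≤rA))
    where
    FA = sumFin k (λ e → 𝟙 (lookup A e ∧ full X e))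
    w : Fin k → ℕ
    w e = 𝟙 (lookup A e) + 𝟙 (lookup A e ∧ full X e)
    Σw≡ : sumFin k w ≡ ∣ A ∣ + FA
    Σw≡ = trans (sumFin-+ k _ _) (cong (_+ FA) (sym (∣p∣≡sumFin A)))
    pointwise : ∀ x₀ x₁ a → 𝟙 x₀ + (𝟙 x₁ + 0) ≤
      (𝟙 a + 𝟙 (a ∧ (x₀ ∧ x₁))) + (𝟙 (x₀ ∧ not a) + (𝟙 (x₁ ∧ not a) + 0))
    pointwise true  true  true  = ≤-refl
    pointwise true  false true  = s≤s z≤n
    pointwise false true  true  = s≤s z≤n
    pointwise false false true  = z≤n
    pointwise true  true  false = ≤-refl
    pointwise true  false false = ≤-refl
    pointwise false true  false = ≤-refl
    pointwise false false false = ≤-refl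
    FA≤∣A∣ : FA ≤ ∣ A ∣
    FA≤∣A∣ = subst (FA ≤_) (sym (∣p∣≡sumFin A)) (sumFin-mono k (λ e → ∧-𝟙ˡ (lookup A e) (full X e)))
      where
      ∧-𝟙ˡ : ∀ a b → 𝟙 (a ∧ b) ≤ 𝟙 a
      ∧-𝟙ˡ true  b = 𝟙≤1 b
      ∧-𝟙ˡ false b = z≤n
    FA≤1 : FA ≤ 1
    FA≤1 = ≤-trans (sumFin-mono k (λ e → ∧-𝟙ʳ (lookup A e) (full X e))) F≤1
      where
      ∧-𝟙ʳ : ∀ a b → 𝟙 (a ∧ b) ≤ 𝟙 b
      ∧-𝟙ʳ true  b = ≤-refl
      ∧-𝟙ʳ false b = z≤n
    ∣A∣+FA≤rA : ∣ A ∣ + FA ≤ r A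
    ∣A∣+FA≤rA with ∣ A ∣ ≟ 0
    ... | yes ∣A∣≡0 = subst (∣ A ∣ + FA ≤_) (sym (r-empty A ∣A∣≡0))
                        (≤-trans (+-mono-≤ (≤-reflexive ∣A∣≡0) (≤-trans FA≤∣A∣ (≤-reflexive ∣A∣≡0))) z≤n)
    ... | no  ∣A∣≢0 = subst (∣ A ∣ + FA ≤_) (sym (trans (r-nonempty A ∣A∣≢0) (+-comm 1 ∣ A ∣)))
                        (+-monoʳ-≤ ∣ A ∣ FA≤1)

-- Point (e , 0) is the unit vector u_e and point (e , 1) is p + u_e, for a common point p.
lines : ∀ {k} → Representation {k} two (suc k)
lines e i zero    = δ i (suc zero)
lines e i (suc j) = δ e j

module _ {k : ℕ} (Y : PointSet {k} two) where

  vsum-lines-zero : vsum two lines Y zero ≡ xorFin k (λ e → Y e (suc zero))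
  vsum-lines-zero = xorFin-cong k (λ e → simplify (Y e zero) (Y e (suc zero)))
    where
    simplify : ∀ a b → (a ∧ false) xor ((b ∧ true) xor false) ≡ b
    simplify a b rewrite ∧-zeroʳ a | ∧-identityʳ b = xor-identityʳ b

  vsum-lines-suc : ∀ j → vsum two lines Y (suc j) ≡ Y j zero xor Y j (suc zero)
  vsum-lines-suc j = trans
    (xorFin-cong k (λ e → trans (cong (Y e zero ∧ δ e j xor_) (xor-identityʳ _))
                               (sym (∧-distribʳ-xor (δ e j) (Y e zero) (Y e (suc zero))))))
    (xorFin-δ k (λ e → Y e zero xor Y e (suc zero)) j)

module _ {k : ℕ} (X : PointSet {k} two) where

  linIndep⇒fullBlocks≤1 : LinearlyIndependent two lines X → fullBlocks X ≤ 1
  linIndep⇒fullBlocks≤1 lin with fullBlocks X ≤? 1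
  ... | yes F≤1 = F≤1
  ... | no  F≰1 with sumFin𝟙≥2 k (full X) (≰⇒> F≰1)
  ...   | e , e′ , e≢e′ , full-e , full-e′ =
    ⊥-elim (lin Y Y⊆X (size-positive⁺ Y e zero Ye) sum≡0)
    where
    Y : PointSet two
    Y x _ = δ x e xor δ x e′
    Ye : Y e zero ≡ true
    Ye = cong₂ _xor_ (δ-refl e) (δ-≢ e≢e′)
    full⇒⊆ : ∀ {x} → full X x ≡ true → ∀ i → X x i ≡ true
    full⇒⊆ {x} full-x zero       with X x zero | full-x
    ... | true | _ = refl
    full⇒⊆ {x} full-x (suc zero) with X x zero | X x (suc zero) | full-x
    ... | true | true | _ = refl
    Y⊆X : _⊆ₚ_ two Y X
    Y⊆X x i Yxi with x Fin.≟ e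
    ... | yes refl = full⇒⊆ full-e i
    ... | no  _    = subst (λ y → X y i ≡ true) (sym (δ≡true Yxi)) (full⇒⊆ full-e′ i)
    sum≡0 : ZeroSum two lines Y
    sum≡0 zero    = begin
      vsum two lines Y zero
        ≡⟨ vsum-lines-zero Y ⟩
      xorFin k (λ x → δ x e xor δ x e′)
        ≡⟨ xorFin-xor k (λ x → δ x e) (λ x → δ x e′) ⟩
      xorFin k (λ x → δ x e) xor xorFin k (λ x → δ x e′)
        ≡⟨ cong₂ _xor_ (xorFin-δ k (λ _ → true) e) (xorFin-δ k (λ _ → true) e′) ⟩
      false ∎
      where open ≡-Reasoning
    sum≡0 (suc j) = trans (vsum-lines-suc Y j) (xor-same (Y j zero))

  fullBlocks≤1⇒linIndep : fullBlocks X ≤ 1 → LinearlyIndependent two lines X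
  fullBlocks≤1⇒linIndep F≤1 Y Y⊆X pos sum≡0 with size-positive Y pos
  ... | e , i , Yei =
    case trans (sym Ye₁) (trans (sym only-e) (trans (sym (vsum-lines-zero Y)) (sum≡0 zero))) of λ ()
    where
    -- The coordinates of the unit vectors force both or neither point of each block into Y.
    Y₀≡Y₁ : ∀ x → Y x zero ≡ Y x (suc zero)
    Y₀≡Y₁ x = xor≡false⇒≡ (trans (sym (vsum-lines-suc Y x)) (sum≡0 (suc x)))
    Y₁ : ∀ {x} i → Y x i ≡ true → Y x (suc zero) ≡ true
    Y₁ {x} zero       Yx₀ = trans (sym (Y₀≡Y₁ x)) Yx₀
    Y₁     (suc zero) Yx₁ = Yx₁
    Ye₁ : Y e (suc zero) ≡ true
    Ye₁ = Y₁ i Yei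
    full-X : ∀ {x} → Y x (suc zero) ≡ true → 1 ≤ 𝟙 (full X x)
    full-X {x} Yx₁ = subst (λ b → 1 ≤ 𝟙 b)
      (sym (cong₂ _∧_ (Y⊆X x zero (trans (Y₀≡Y₁ x) Yx₁)) (Y⊆X x (suc zero) Yx₁))) ≤-refl
    others : ∀ x → x ≢ e → Y x (suc zero) ≡ false
    others x x≢e with Y x (suc zero) in Yx₁
    ... | false = refl
    ... | true  = ⊥-elim (<⇒≱ (two-terms≤sumFin k _ x≢e (full-X Yx₁) (full-X Ye₁)) F≤1)
    only-e : xorFin k (λ x → Y x (suc zero)) ≡ Y e (suc zero)
    only-e = xorFin-single k _ e others

binaryNatural-lines : ∀ {k} (r : Subset k → ℕ) → (∀ Z → ∣ Z ∣ ≡ 0 → r Z ≡ 0) →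
  (∀ Z → ∣ Z ∣ ≢ 0 → r Z ≡ suc ∣ Z ∣) → BinaryNatural two r
binaryNatural-lines {k} r r-empty r-nonempty = suc k , lines , λ X → mk⇔
  (fullBlocks≤1⇒linIndep X ∘ independent⇒fullBlocks≤1 r r-empty r-nonempty X)
  (fullBlocks≤1⇒independent r r-empty r-nonempty X ∘ linIndep⇒fullBlocks≤1 X)

MonotoneUpTo : ℕ → (ℕ → ℕ) → Set
MonotoneUpTo n g = ∀ {a b} → a ≤ b → b ≤ n → g a ≤ g b

SubmodularUpTo : ℕ → (ℕ → ℕ) → Set
SubmodularUpTo n g = ∀ {a b u i} → i ≤ a → i ≤ b → a ≤ u → b ≤ u → u ≤ n → u + i ≡ a + b →
  g u + g i ≤ g a + g b

cardinality-polymatroid : ∀ {n} (ρ : RankFn n) (g : ℕ → ℕ) → (∀ Z → ρ Z ≡ g ∣ Z ∣) →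
  g 0 ≡ 0 → MonotoneUpTo n g → SubmodularUpTo n g → IsPolymatroid n ρ
cardinality-polymatroid {n} ρ g ρ≡g g0≡0 mono submod = record
  { empty  = trans (ρ≡g ⊥) (trans (cong g (∣⊥∣≡0 n)) g0≡0)
  ; mono   = λ X Y X⊆Y → subst₂ _≤_ (sym (ρ≡g X)) (sym (ρ≡g Y)) (mono (p⊆q⇒∣p∣≤∣q∣ X⊆Y) (∣p∣≤n Y))
  ; submod = λ X Y → subst₂ _≤_ (sym (cong₂ _+_ (ρ≡g (X ∪ Y)) (ρ≡g (X ∩ Y)))) (sym (cong₂ _+_ (ρ≡g X) (ρ≡g Y)))
      (submod (∣p∩q∣≤∣p∣ X Y) (∣p∩q∣≤∣q∣ X Y) (∣p∣≤∣p∪q∣ X Y) (∣q∣≤∣p∪q∣ X Y)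
              (∣p∣≤n (X ∪ Y)) (∣p∪q∣+∣p∩q∣≡∣p∣+∣q∣ X Y))
  }

σ : ℕ → ℕ → ℕ
σ n c with c ≟ 0 | c ≟ n
... | yes _ | _     = c
... | no _  | yes _ = c
... | no _  | no _  = suc c

S≡σ : ∀ n X → S n X ≡ σ n ∣ X ∣
S≡σ n X with ∣ X ∣ ≟ 0 | ∣ X ∣ ≟ n
... | yes _ | _     = refl
... | no _  | yes _ = refl
... | no _  | no _  = refl

σ-full : ∀ n → σ n n ≡ n
σ-full n with n ≟ 0 | n ≟ n
... | yes _ | _       = refl
... | no _  | yes _   = refl
... | no _  | no n≢n  = ⊥-elim (n≢n refl)

σ-mid : ∀ {n c} → c ≢ 0 → c ≢ n → σ n c ≡ suc c
σ-mid {n} {c} c≢0 c≢n with c ≟ 0 | c ≟ n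
... | yes c≡0 | _       = ⊥-elim (c≢0 c≡0)
... | no _    | yes c≡n = ⊥-elim (c≢n c≡n)
... | no _    | no _    = refl

≤σ : ∀ n c → c ≤ σ n c
≤σ n c with c ≟ 0 | c ≟ n
... | yes _ | _     = ≤-refl
... | no _  | yes _ = ≤-refl
... | no _  | no _  = n≤1+n c

σ≤suc : ∀ n c → σ n c ≤ suc c
σ≤suc n c with c ≟ 0 | c ≟ n
... | yes _ | _     = n≤1+n c
... | no _  | yes _ = n≤1+n c
... | no _  | no _  = ≤-refl

σ-monotone : ∀ n → MonotoneUpTo n (σ n)
σ-monotone n {a} {b} a≤b b≤n = by-cases (a ≟ 0) (b ≟ n) (a ≟ b)
  where
  by-cases : Dec (a ≡ 0) → Dec (b ≡ n) → Dec (a ≡ b) → σ n a ≤ σ n b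
  by-cases (yes refl) _          _          = z≤n
  by-cases (no a≢0)   (no b≢n)   _          =
    ≤-trans (σ≤suc n a) (subst (suc a ≤_) (sym (σ-mid b≢0 b≢n)) (s≤s a≤b))
    where
    b≢0 : b ≢ 0
    b≢0 b≡0 = a≢0 (n≤0⇒n≡0 (subst (a ≤_) b≡0 a≤b))
  by-cases (no _)     (yes refl) (yes refl) = ≤-refl
  by-cases (no _)     (yes refl) (no a≢b)   =
    ≤-trans (σ≤suc b a) (≤-trans (≤∧≢⇒< a≤b a≢b) (≤-reflexive (sym (σ-full b))))

-- Off the extremes σ n is c ↦ c + 1, which is modular; at an extreme the inequality is an equality.
σ-submodular : ∀ n → SubmodularUpTo n (σ n)
σ-submodular n {a} {b} {u} {i} i≤a i≤b a≤u b≤u u≤n u+i≡a+b = by-cases (a ≟ 0) (a ≟ n) (b ≟ 0) (b ≟ n)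
  where
  σ-swap : ∀ a b → σ n u + σ n i ≤ σ n b + σ n a → σ n u + σ n i ≤ σ n a + σ n b
  σ-swap a b p = ≤-trans p (≤-reflexive (+-comm (σ n b) (σ n a)))
  at-zero : ∀ {a b} → i ≤ a → u + i ≡ a + b → a ≡ 0 → σ n u + σ n i ≤ σ n a + σ n b
  at-zero i≤a u+i≡a+b refl with n≤0⇒n≡0 i≤a
  ... | refl = ≤-reflexive (trans (+-identityʳ (σ n u)) (cong (σ n) (trans (sym (+-identityʳ u)) u+i≡a+b)))
  at-full : ∀ {a b} → a ≤ u → u + i ≡ a + b → a ≡ n → σ n u + σ n i ≤ σ n a + σ n b
  at-full a≤u u+i≡a+b refl with ≤-antisym u≤n a≤u
  ... | refl = ≤-reflexive (cong (λ c → σ n u + σ n c) (+-cancelˡ-≡ u i _ u+i≡a+b))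
  by-cases : Dec (a ≡ 0) → Dec (a ≡ n) → Dec (b ≡ 0) → Dec (b ≡ n) → σ n u + σ n i ≤ σ n a + σ n b
  by-cases (yes a≡0) _         _         _         = at-zero i≤a u+i≡a+b a≡0
  by-cases (no _)    (yes a≡n) _         _         = at-full a≤u u+i≡a+b a≡n
  by-cases (no _)    (no _)    (yes b≡0) _         = σ-swap a b (at-zero i≤b (trans u+i≡a+b (+-comm a b)) b≡0)
  by-cases (no _)    (no _)    (no _)    (yes b≡n) = σ-swap a b (at-full b≤u (trans u+i≡a+b (+-comm a b)) b≡n)
  by-cases (no a≢0)  (no a≢n)  (no b≢0)  (no b≢n)  = begin
    σ n u + σ n i       ≤⟨ +-mono-≤ (σ≤suc n u) (σ≤suc n i) ⟩
    suc u + suc i       ≡⟨ cong suc (trans (+-suc u i) (cong suc u+i≡a+b)) ⟩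
    suc (suc (a + b))   ≡⟨ cong suc (sym (+-suc a b)) ⟩
    suc a + suc b       ≡⟨ sym (cong₂ _+_ (σ-mid a≢0 a≢n) (σ-mid b≢0 b≢n)) ⟩
    σ n a + σ n b       ∎
    where open ≤-Reasoning

S-isPolymatroid : ∀ n → IsPolymatroid n (S n)
S-isPolymatroid n = cardinality-polymatroid (S n) (σ n) (S≡σ n) refl (σ-monotone n) (σ-submodular n)

∣X∣≤S : ∀ n X → ∣ X ∣ ≤ S n X
∣X∣≤S n X = subst (∣ X ∣ ≤_) (sym (S≡σ n X)) (≤σ n ∣ X ∣)

S-mid : ∀ n X → ∣ X ∣ ≢ 0 → ∣ X ∣ ≢ n → S n X ≡ suc ∣ X ∣
S-mid n X ∣X∣≢0 ∣X∣≢n = trans (S≡σ n X) (σ-mid ∣X∣≢0 ∣X∣≢n)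

S-singleton : ∀ n′ (e : Fin (suc (suc n′))) → S (suc (suc n′)) ⁅ e ⁆ ≡ 2
S-singleton n′ e = trans (S≡σ _ ⁅ e ⁆) (cong (σ (suc (suc n′))) (∣⁅x⁆∣≡1 e))

module NotBinary (n′ : ℕ) where

  n : ℕ
  n = suc (suc n′)

  pick : Bool → Bool → Bool → Bool → PointSet {n} two
  pick x y z w zero          zero       = x
  pick x y z w zero          (suc zero) = y
  pick x y z w (suc zero)    zero       = z
  pick x y z w (suc zero)    (suc zero) = w
  pick x y z w (suc (suc e)) zero       = true
  pick x y z w (suc (suc e)) (suc zero) = false

  count : Bool → Bool → Bool → Bool → ℕ
  count x y z w = (𝟙 x + 𝟙 y) + (𝟙 z + 𝟙 w)

  size-pick : ∀ x y z w → size two (pick x y z w) ≡ count x y z w + n′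
  size-pick x y z w = begin
    (𝟙 x + (𝟙 y + 0)) + ((𝟙 z + (𝟙 w + 0)) + sumFin n′ (λ _ → 1))
      ≡⟨ cong₂ (λ a b → a + (b + sumFin n′ (λ _ → 1)))
               (cong (𝟙 x +_) (+-identityʳ _)) (cong (𝟙 z +_) (+-identityʳ _)) ⟩
    (𝟙 x + 𝟙 y) + ((𝟙 z + 𝟙 w) + sumFin n′ (λ _ → 1))
      ≡⟨ cong (λ t → (𝟙 x + 𝟙 y) + ((𝟙 z + 𝟙 w) + t)) (sumFin-one n′) ⟩
    (𝟙 x + 𝟙 y) + ((𝟙 z + 𝟙 w) + n′)
      ≡⟨ sym (+-assoc (𝟙 x + 𝟙 y) _ n′) ⟩
    count x y z w + n′ ∎
    where open ≡-Reasoning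

  pick-dependent : ∀ x y z w → count x y z w ≡ 3 → ¬ Independent two (S n) (pick x y z w)
  pick-dependent x y z w count≡3 ind = <-irrefl refl (begin-strict
    n                        <⟨ n<1+n n ⟩
    3 + n′                   ≡⟨ cong (_+ n′) (sym count≡3) ⟩
    count x y z w + n′       ≡⟨ sym (size-pick x y z w) ⟩
    size two (pick x y z w)  ≤⟨ independent⇒size≤ two {S n} {pick x y z w} ind ⟩
    S n ⊤                    ≡⟨ trans (S≡σ n ⊤) (trans (cong (σ n) (∣⊤∣≡n n)) (σ-full n)) ⟩
    n                        ∎)
    where open ≤-Reasoning

  S-proper-nonempty : ∀ (A : Subset n) (A′ : Subset n′) → ∣ A ∣ ≡ suc ∣ A′ ∣ → S n A ≡ 2 + ∣ A′ ∣
  S-proper-nonempty A A′ ∣A∣≡ = trans (S-mid n A (λ ∣A∣≡0 → case trans (sym ∣A∣≡) ∣A∣≡0 of λ ()) ∣A∣≢n)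
                                    (cong suc ∣A∣≡)
    where
    ∣A∣≢n : ∣ A ∣ ≢ n
    ∣A∣≢n ∣A∣≡n = <-irrefl refl (subst (_≤ n′) (ℕ.suc-injective (trans (sym ∣A∣≡) ∣A∣≡n)) (∣p∣≤n A′))

  -- Charge each block of A with the points of X it contains; the charges add up to at most S n A.
  pick-independent : ∀ x y z w → count x y z w ≡ 2 → Independent two (S n) (pick x y z w)
  pick-independent x y z w count≡2 (a₀ ∷ a₁ ∷ A′) =
    ≤-trans (size≤sumFin+size∖ (pick x y z w) A weight
              λ { zero → block a₀ x y ; (suc zero) → block a₁ z w ; (suc (suc e)) → rest (lookup A′ e) })
            (+-monoˡ-≤ _ (weight≤S a₀ a₁))
    where
    A : Subset n
    A = a₀ ∷ a₁ ∷ A′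
    weight : Fin n → ℕ
    weight zero          = if a₀ then 𝟙 x + 𝟙 y else 0
    weight (suc zero)    = if a₁ then 𝟙 z + 𝟙 w else 0
    weight (suc (suc e)) = 𝟙 (lookup A′ e)
    block : ∀ a x y → 𝟙 x + (𝟙 y + 0) ≤ (if a then 𝟙 x + 𝟙 y else 0) + (𝟙 (x ∧ not a) + (𝟙 (y ∧ not a) + 0))
    block true  true  true  = ≤-refl
    block true  true  false = ≤-refl
    block true  false true  = ≤-refl
    block true  false false = ≤-refl
    block false true  true  = ≤-refl
    block false true  false = ≤-refl
    block false false true  = ≤-refl
    block false false false = ≤-refl
    rest : ∀ a → 1 ≤ 𝟙 a + (𝟙 (not a) + 0)
    rest true  = ≤-refl
    rest false = ≤-refl
    Σ′ = sumFin n′ (𝟙 ∘ lookup A′)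
    weight≤S : ∀ a₀ a₁ →
      (if a₀ then 𝟙 x + 𝟙 y else 0) + ((if a₁ then 𝟙 z + 𝟙 w else 0) + Σ′) ≤ S n (a₀ ∷ a₁ ∷ A′)
    weight≤S true  true  = subst (_≤ S n (true ∷ true ∷ A′))
      (trans (cong (2 +_) (∣p∣≡sumFin A′)) (trans (cong (_+ Σ′) (sym count≡2)) (+-assoc (𝟙 x + 𝟙 y) _ Σ′)))
      (∣X∣≤S n (true ∷ true ∷ A′))
    weight≤S false false = subst (_≤ S n (false ∷ false ∷ A′)) (∣p∣≡sumFin A′) (∣X∣≤S n (false ∷ false ∷ A′))
    weight≤S true  false = ≤-trans (+-monoˡ-≤ Σ′ (subst (𝟙 x + 𝟙 y ≤_) count≡2 (m≤m+n _ _)))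
      (≤-reflexive (trans (cong (2 +_) (sym (∣p∣≡sumFin A′))) (sym (S-proper-nonempty (true ∷ false ∷ A′) A′ refl))))
    weight≤S false true  = ≤-trans (+-monoˡ-≤ Σ′ (subst (𝟙 z + 𝟙 w ≤_) count≡2 (m≤n+m _ (𝟙 x + 𝟙 y))))
      (≤-reflexive (trans (cong (2 +_) (sym (∣p∣≡sumFin A′))) (sym (S-proper-nonempty (false ∷ true ∷ A′) A′ refl))))

  ⊆pick⊤ : ∀ {Y x y z w} → _⊆ₚ_ two Y (pick x y z w) → _⊆ₚ_ two Y (pick true true true true)
  ⊆pick⊤ Y⊆ zero          zero       _   = refl
  ⊆pick⊤ Y⊆ zero          (suc zero) _   = refl
  ⊆pick⊤ Y⊆ (suc zero)    zero       _   = refl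
  ⊆pick⊤ Y⊆ (suc zero)    (suc zero) _   = refl
  ⊆pick⊤ Y⊆ (suc (suc e)) zero       _   = refl
  ⊆pick⊤ Y⊆ (suc (suc e)) (suc zero) Yei = Y⊆ (suc (suc e)) (suc zero) Yei

  ⊆pick : ∀ {Y x y z w} → _⊆ₚ_ two Y (pick true true true true) →
    (Y zero zero ≡ true → x ≡ true) → (Y zero (suc zero) ≡ true → y ≡ true) →
    (Y (suc zero) zero ≡ true → z ≡ true) → (Y (suc zero) (suc zero) ≡ true → w ≡ true) →
    _⊆ₚ_ two Y (pick x y z w)
  ⊆pick Y⊆ hx hy hz hw zero          zero       = hx
  ⊆pick Y⊆ hx hy hz hw zero          (suc zero) = hy
  ⊆pick Y⊆ hx hy hz hw (suc zero)    zero       = hz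
  ⊆pick Y⊆ hx hy hz hw (suc zero)    (suc zero) = hw
  ⊆pick Y⊆ hx hy hz hw (suc (suc e)) zero       = Y⊆ (suc (suc e)) zero
  ⊆pick Y⊆ hx hy hz hw (suc (suc e)) (suc zero) = Y⊆ (suc (suc e)) (suc zero)

  module _ {m} (v : Representation two m)
           (independent : ∀ x y z w → count x y z w ≡ 2 → LinearlyIndependent two v (pick x y z w)) where

    -- A nonempty zero-sum Y contains each point whose removal leaves Y inside an independent set.
    forced : ∀ {X} Y → 0 < size two Y → ZeroSum two v Y → LinearlyIndependent two v X →
      ∀ b → (b ≡ false → _⊆ₚ_ two Y X) → b ≡ true
    forced Y pos sum≡0 lin true  _    = refl
    forced Y pos sum≡0 lin false Y⊆X = ⊥-elim (lin Y (Y⊆X refl) pos sum≡0)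

    -- Y₁ ⊇ {x, y, z} and Y₂ ⊇ {x, y} ∌ z, so Y₁ + Y₂ is a nonempty zero-sum subset of {z, w} ∪ rest.
    twoDependentTriples⇒dependentPair :
      ∀ Y₁ → _⊆ₚ_ two Y₁ (pick true true true false) → 0 < size two Y₁ → ZeroSum two v Y₁ →
      ∀ Y₂ → _⊆ₚ_ two Y₂ (pick true true false true) → 0 < size two Y₂ → ZeroSum two v Y₂ →
      ¬ LinearlyIndependent two v (pick false false true true)
    twoDependentTriples⇒dependentPair Y₁ Y₁⊆ pos₁ sum₁≡0 Y₂ Y₂⊆ pos₂ sum₂≡0 lin =
      lin Y Y⊆ (size-positive⁺ Y (suc zero) zero (cong₂ _xor_ z₁ z₂)) sum≡0
      where
      off : ∀ {b} → b ≡ false → b ≡ true → false ≡ true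
      off b≡false b≡true = trans (sym b≡false) b≡true
      Y₁⊤ = ⊆pick⊤ Y₁⊆
      Y₂⊤ = ⊆pick⊤ Y₂⊆
      x₁ : Y₁ zero zero ≡ true
      x₁ = forced Y₁ pos₁ sum₁≡0 (independent false true true false refl) _ λ x₁≡false →
        ⊆pick Y₁⊤ (off x₁≡false) (λ _ → refl) (λ _ → refl) (Y₁⊆ (suc zero) (suc zero))
      y₁ : Y₁ zero (suc zero) ≡ true
      y₁ = forced Y₁ pos₁ sum₁≡0 (independent true false true false refl) _ λ y₁≡false →
        ⊆pick Y₁⊤ (λ _ → refl) (off y₁≡false) (λ _ → refl) (Y₁⊆ (suc zero) (suc zero))
      z₁ : Y₁ (suc zero) zero ≡ true
      z₁ = forced Y₁ pos₁ sum₁≡0 (independent true true false false refl) _ λ z₁≡false →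
        ⊆pick Y₁⊤ (λ _ → refl) (λ _ → refl) (off z₁≡false) (Y₁⊆ (suc zero) (suc zero))
      x₂ : Y₂ zero zero ≡ true
      x₂ = forced Y₂ pos₂ sum₂≡0 (independent false true false true refl) _ λ x₂≡false →
        ⊆pick Y₂⊤ (off x₂≡false) (λ _ → refl) (Y₂⊆ (suc zero) zero) (λ _ → refl)
      y₂ : Y₂ zero (suc zero) ≡ true
      y₂ = forced Y₂ pos₂ sum₂≡0 (independent true false false true refl) _ λ y₂≡false →
        ⊆pick Y₂⊤ (λ _ → refl) (off y₂≡false) (Y₂⊆ (suc zero) zero) (λ _ → refl)
      z₂ : Y₂ (suc zero) zero ≡ false
      z₂ = ¬-not (λ z₂≡true → case Y₂⊆ (suc zero) zero z₂≡true of λ ())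
      Y : PointSet two
      Y e i = Y₁ e i xor Y₂ e i
      Y⊆ : _⊆ₚ_ two Y (pick false false true true)
      Y⊆ = ⊆pick (⊆-xor two Y₁⊤ Y₂⊤) (off (cong₂ _xor_ x₁ x₂)) (off (cong₂ _xor_ y₁ y₂)) (λ _ → refl) (λ _ → refl)
      sum≡0 : ZeroSum two v Y
      sum≡0 j = trans (vsum-xor two v Y₁ Y₂ j) (cong₂ _xor_ (sum₁≡0 j) (sum₂≡0 j))

  notBinaryNatural : ¬ BinaryNatural two (S n)
  notBinaryNatural (m , v , ind⇔lin) =
    dependent true true true false refl λ Y₁ Y₁⊆ pos₁ sum₁≡0 →
    dependent true true false true refl λ Y₂ Y₂⊆ pos₂ sum₂≡0 →
    twoDependentTriples⇒dependentPair v independent Y₁ Y₁⊆ pos₁ sum₁≡0 Y₂ Y₂⊆ pos₂ sum₂≡0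
      (independent false false true true refl)
    where
    independent : ∀ x y z w → count x y z w ≡ 2 → LinearlyIndependent two v (pick x y z w)
    independent x y z w = Equivalence.to (ind⇔lin _) ∘ pick-independent x y z w
    dependent : ∀ x y z w → count x y z w ≡ 3 → ¬ LinearlyIndependent two v (pick x y z w)
    dependent x y z w count≡3 = pick-dependent x y z w count≡3 ∘ Equivalence.from (ind⇔lin _)

S-notInPU24 : ∀ n′ → ¬ InPU24 (suc (suc n′)) (S (suc (suc n′)))
S-notInPU24 n′ (_ , natBinary) = NotBinary.notBinaryNatural n′
  (binaryNatural-resize (S n) (sym ∘ S-singleton n′)
    (Equivalence.to (natBinary⇔binaryNatural (S n) (IsPolymatroid.empty (S-isPolymatroid n))) natBinary))
  where n = suc (suc n′)

m+n≤o+p⇒m∸t+n∸t≤o∸t+p∸t : ∀ {m n o p t} → t ≤ m → t ≤ n → t ≤ o → t ≤ p →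
  m + n ≤ o + p → (m ∸ t) + (n ∸ t) ≤ (o ∸ t) + (p ∸ t)
m+n≤o+p⇒m∸t+n∸t≤o∸t+p∸t {m} {n} {o} {p} {t} t≤m t≤n t≤o t≤p m+n≤o+p =
  +-cancelʳ-≤ (t + t) _ _ (subst₂ _≤_ (sym (restore t≤m t≤n)) (sym (restore t≤o t≤p)) m+n≤o+p)
  where
  restore : ∀ {a b} → t ≤ a → t ≤ b → ((a ∸ t) + (b ∸ t)) + (t + t) ≡ a + b
  restore {a} {b} t≤a t≤b = trans (interchange (a ∸ t) (b ∸ t) t t) (cong₂ _+_ (m∸n+n≡m t≤a) (m∸n+n≡m t≤b))

module _ {n : ℕ} {g : ℕ → ℕ} (mono : MonotoneUpTo n g) {k c : ℕ} (k+c≤n : k + c ≤ n) where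

  private
    z+c≤n : ∀ {z} → z ≤ k → z + c ≤ n
    z+c≤n z≤k = ≤-trans (+-monoˡ-≤ c z≤k) k+c≤n
    gc≤ : ∀ {z} → z ≤ k → g c ≤ g (z + c)
    gc≤ z≤k = mono (m≤n+m _ _) (z+c≤n z≤k)

  contract-monotone : MonotoneUpTo k (λ z → g (z + c) ∸ g c)
  contract-monotone a≤b b≤k = ∸-monoˡ-≤ (g c) (mono (+-monoˡ-≤ c a≤b) (z+c≤n b≤k))

  contract-submodular : SubmodularUpTo n g → SubmodularUpTo k (λ z → g (z + c) ∸ g c)
  contract-submodular submod {a} {b} {u} {i} i≤a i≤b a≤u b≤u u≤k u+i≡a+b =
    m+n≤o+p⇒m∸t+n∸t≤o∸t+p∸t (gc≤ u≤k) (gc≤ (≤-trans i≤a a≤k)) (gc≤ a≤k) (gc≤ (≤-trans b≤u u≤k))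
      (submod (+-monoˡ-≤ c i≤a) (+-monoˡ-≤ c i≤b) (+-monoˡ-≤ c a≤u) (+-monoˡ-≤ c b≤u) (z+c≤n u≤k) shifted)
    where
    a≤k = ≤-trans a≤u u≤k
    shifted : (u + c) + (i + c) ≡ (a + c) + (b + c)
    shifted = trans (interchange u c i c) (trans (cong (_+ (c + c)) u+i≡a+b) (sym (interchange a c b c)))

σ/ : ℕ → ℕ → ℕ → ℕ
σ/ n c z = σ n (z + c) ∸ σ n c

σ/-uncontracted : ∀ n z → σ/ n 0 z ≡ σ n z
σ/-uncontracted n z = cong (σ n) (+-identityʳ z)

σ/-below : ∀ {n c z} → c ≢ 0 → z + c < n → σ/ n c z ≡ z
σ/-below {n} {c} {z} c≢0 z+c<n = begin
  σ n (z + c) ∸ σ n c   ≡⟨ cong₂ _∸_ (σ-mid (c≢0 ∘ m+n≡0⇒n≡0 z) (<⇒≢ z+c<n)) (σ-mid c≢0 (<⇒≢ c<n)) ⟩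
  suc (z + c) ∸ suc c   ≡⟨ m+n∸n≡m z c ⟩
  z                     ∎
  where
  open ≡-Reasoning
  c<n : c < n
  c<n = ≤-<-trans (m≤n+m c z) z+c<n

σ/-top : ∀ {n c z} → c ≢ 0 → suc z + c ≡ n → σ/ n c (suc z) ≡ z
σ/-top {n} {c} {z} c≢0 refl = begin
  σ n n ∸ σ n c      ≡⟨ cong₂ _∸_ (σ-full n) (σ-mid c≢0 (<⇒≢ (m<n+m c z<s))) ⟩
  suc z + c ∸ suc c  ≡⟨ m+n∸n≡m z c ⟩
  z                  ∎
  where open ≡-Reasoning

r-singleton : ∀ {n c k} {r : Subset k → ℕ} → (∀ Z → r Z ≡ σ/ n c ∣ Z ∣) → ∀ e → r ⁅ e ⁆ ≡ σ/ n c 1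
r-singleton {n} {c} r≡σ/ e = trans (r≡σ/ ⁅ e ⁆) (cong (σ/ n c) (∣⁅x⁆∣≡1 e))

σ/-singleton≤2 : ∀ n c → σ/ n c 1 ≤ 2
σ/-singleton≤2 n c = ≤-trans (∸-mono (σ≤suc n (1 + c)) (≤σ n c)) (≤-reflexive (m+n∸n≡m 2 c))

minor-is2Polymatroid : ∀ {n c k} (r : Subset k → ℕ) → k + c ≤ n → (∀ Z → r Z ≡ σ/ n c ∣ Z ∣) →
  Is2Polymatroid k r
minor-is2Polymatroid {n} {c} r k+c≤n r≡σ/ =
  cardinality-polymatroid r (σ/ n c) r≡σ/ (n∸n≡0 (σ n c)) (contract-monotone (σ-monotone n) k+c≤n)
    (contract-submodular (σ-monotone n) k+c≤n (σ-submodular n)) ,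
  λ e → ≤-trans (≤-reflexive (r-singleton {n} {c} r≡σ/ e)) (σ/-singleton≤2 n c)

module _ {n c : ℕ} where

  deletion-binaryNatural : ∀ {k} (r : Subset k → ℕ) → (∀ Z → r Z ≡ σ/ n c ∣ Z ∣) →
    c ≡ 0 → k < n → BinaryNatural (λ e → r ⁅ e ⁆) r
  deletion-binaryNatural r r≡σ/ refl k<n =
    binaryNatural-resize r r-singleton≡2 (binaryNatural-lines r r-empty r-nonempty)
    where
    r≡σ : ∀ Z → r Z ≡ σ n ∣ Z ∣
    r≡σ Z = trans (r≡σ/ Z) (σ/-uncontracted n ∣ Z ∣)
    r-empty : ∀ Z → ∣ Z ∣ ≡ 0 → r Z ≡ 0
    r-empty Z ∣Z∣≡0 = trans (r≡σ Z) (cong (σ n) ∣Z∣≡0)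
    r-nonempty : ∀ Z → ∣ Z ∣ ≢ 0 → r Z ≡ suc ∣ Z ∣
    r-nonempty Z ∣Z∣≢0 = trans (r≡σ Z) (σ-mid ∣Z∣≢0 (<⇒≢ (≤-<-trans (∣p∣≤n Z) k<n)))
    r-singleton≡2 : ∀ e → r ⁅ e ⁆ ≡ 2
    r-singleton≡2 e = trans (r-nonempty ⁅ e ⁆ (λ ∣⁅e⁆∣≡0 → case trans (sym (∣⁅x⁆∣≡1 e)) ∣⁅e⁆∣≡0 of λ ()))
                            (cong suc (∣⁅x⁆∣≡1 e))

  free-binaryNatural : ∀ {k} (r : Subset k → ℕ) → (∀ Z → r Z ≡ σ/ n c ∣ Z ∣) →
    c ≢ 0 → k + c < n → BinaryNatural (λ e → r ⁅ e ⁆) r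
  free-binaryNatural r r≡σ/ c≢0 k+c<n =
    binaryNatural-resize r (λ e → trans (r-card ⁅ e ⁆) (∣⁅x⁆∣≡1 e)) (binaryNatural-free r r-card)
    where
    r-card : ∀ Z → r Z ≡ ∣ Z ∣
    r-card Z = trans (r≡σ/ Z) (σ/-below c≢0 (≤-<-trans (+-monoˡ-≤ c (∣p∣≤n Z)) k+c<n))

  contraction-binaryNatural : ∀ {k} (r : Subset k → ℕ) → (∀ Z → r Z ≡ σ/ n c ∣ Z ∣) →
    c ≢ 0 → k + c ≡ n → BinaryNatural (λ e → r ⁅ e ⁆) r
  contraction-binaryNatural {zero}        r r≡σ/ c≢0 k+c≡n = binaryNatural-noPoints r (λ ())
  contraction-binaryNatural {suc zero}    r r≡σ/ c≢0 k+c≡n =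
    binaryNatural-noPoints r (λ e → trans (r-singleton {n} {c} r≡σ/ e) (σ/-top c≢0 k+c≡n))
  contraction-binaryNatural {suc (suc k₁)} r r≡σ/ c≢0 k+c≡n =
    binaryNatural-resize r (λ e → trans (r-singleton {n} {c} r≡σ/ e) (σ/-below c≢0 (below (s≤s (s≤s z≤n)))))
      (binaryNatural-circuit r r-proper r-full)
    where
    below : ∀ {z} → z < suc (suc k₁) → z + c < n
    below z<k = subst (_ <_) k+c≡n (+-monoˡ-< c z<k)
    r-proper : ∀ Z → ∣ Z ∣ ≢ suc (suc k₁) → r Z ≡ ∣ Z ∣
    r-proper Z ∣Z∣≢k = trans (r≡σ/ Z) (σ/-below c≢0 (below (≤∧≢⇒< (∣p∣≤n Z) ∣Z∣≢k)))
    r-full : ∀ Z → ∣ Z ∣ ≡ suc (suc k₁) → r Z ≡ suc k₁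
    r-full Z ∣Z∣≡k = trans (r≡σ/ Z) (trans (cong (σ/ n c) ∣Z∣≡k) (σ/-top c≢0 k+c≡n))

∈-image⁻ : ∀ {k n} (ι : Fin k → Fin n) Z {x} → x ∈ image ι Z → ∃ λ j → ι j ≡ x
∈-image⁻ {zero}  ι []          x∈ = ⊥-elim (∉⊥ x∈)
∈-image⁻ {suc k} ι (true ∷ Z)  x∈ with x∈p∪q⁻ ⁅ ι zero ⁆ (image (ι ∘ suc) Z) x∈
... | inj₁ x∈⁅ι0⁆ = zero , sym (x∈⁅y⁆⇒x≡y (ι zero) x∈⁅ι0⁆)
... | inj₂ x∈rest = let (j , ιj≡x) = ∈-image⁻ (ι ∘ suc) Z x∈rest in suc j , ιj≡x
∈-image⁻ {suc k} ι (false ∷ Z) x∈ with x∈p∪q⁻ ⊥ (image (ι ∘ suc) Z) x∈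
... | inj₁ x∈⊥    = ⊥-elim (∉⊥ x∈⊥)
... | inj₂ x∈rest = let (j , ιj≡x) = ∈-image⁻ (ι ∘ suc) Z x∈rest in suc j , ιj≡x

∈-image⁺ : ∀ {k n} (ι : Fin k → Fin n) Z {j} → j ∈ Z → ι j ∈ image ι Z
∈-image⁺ ι (true ∷ Z) Vec.here         = x∈p∪q⁺ (inj₁ (x∈⁅x⁆ (ι zero)))
∈-image⁺ ι (b ∷ Z)    (Vec.there j∈Z) = x∈p∪q⁺ (inj₂ (∈-image⁺ (ι ∘ suc) Z j∈Z))

∣image∣ : ∀ {k n} (ι : Fin k → Fin n) → (∀ j₁ j₂ → ι j₁ ≡ ι j₂ → j₁ ≡ j₂) → ∀ Z → ∣ image ι Z ∣ ≡ ∣ Z ∣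
∣image∣ {n = n} ι injective []          = ∣⊥∣≡0 n
∣image∣         ι injective (true ∷ Z)  = begin
  ∣ ⁅ ι zero ⁆ ∪ image (ι ∘ suc) Z ∣        ≡⟨ ∣p∪q∣≡∣p∣+∣q∣ ι0∉rest ⟩
  ∣ ⁅ ι zero ⁆ ∣ + ∣ image (ι ∘ suc) Z ∣    ≡⟨ cong₂ _+_ (∣⁅x⁆∣≡1 (ι zero)) (∣image∣ (ι ∘ suc) injective-suc Z) ⟩
  suc ∣ Z ∣                                 ∎
  where
  open ≡-Reasoning
  injective-suc : ∀ j₁ j₂ → ι (suc j₁) ≡ ι (suc j₂) → j₁ ≡ j₂
  injective-suc j₁ j₂ = suc-injective ∘ injective (suc j₁) (suc j₂)
  ι0∉rest : ∀ x → x ∈ ⁅ ι zero ⁆ → x ∉ image (ι ∘ suc) Z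
  ι0∉rest x x∈⁅ι0⁆ x∈rest with ∈-image⁻ (ι ∘ suc) Z x∈rest
  ... | j , ιj≡x = case injective zero (suc j) (trans (sym (x∈⁅y⁆⇒x≡y (ι zero) x∈⁅ι0⁆)) (sym ιj≡x)) of λ ()
∣image∣         ι injective (false ∷ Z) =
  trans (cong ∣_∣ (∪-identityˡ (image (ι ∘ suc) Z)))
        (∣image∣ (ι ∘ suc) (λ j₁ j₂ → suc-injective ∘ injective (suc j₁) (suc j₂)) Z)

minor-binaryNatural : ∀ {n c d k} (r : Subset k → ℕ) → (∀ Z → r Z ≡ σ/ n c ∣ Z ∣) →
  n ≡ k + (d + c) → 0 < d + c → BinaryNatural (λ e → r ⁅ e ⁆) r
minor-binaryNatural {n} {c} {d} {k} r r≡σ/ refl 0<d+c = by-cases (c ≟ 0) (d ≟ 0)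
  where
  by-cases : Dec (c ≡ 0) → Dec (d ≡ 0) → BinaryNatural (λ e → r ⁅ e ⁆) r
  by-cases (yes c≡0) _         = deletion-binaryNatural r r≡σ/ c≡0 (m<m+n k 0<d+c)
  by-cases (no c≢0)  (no d≢0)  = free-binaryNatural r r≡σ/ c≢0 (+-monoʳ-< k (m<n+m c (n≢0⇒n>0 d≢0)))
  by-cases (no c≢0)  (yes d≡0) = contraction-binaryNatural r r≡σ/ c≢0 (cong (λ d → k + (d + c)) (sym d≡0))

module LabelledMinor {n} (D C : Subset n) (disjoint : ∀ x → x ∈ D → x ∉ C)
                     {k} (ι : Fin k → Fin n) (labelling : IsLabelling (D ∪ C) ι) where

  private
    R = D ∪ C
    injective = proj₁ labelling
    ι∉R : ∀ j → ι j ∉ R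
    ι∉R j = Equivalence.from (proj₂ labelling (ι j)) (j , refl)

  minorRank-S : ∀ Z → minorRank (S n) C ι Z ≡ σ/ n ∣ C ∣ ∣ Z ∣
  minorRank-S Z = cong₂ _∸_ (trans (S≡σ n (image ι Z ∪ C)) (cong (σ n) ∣image∪C∣)) (S≡σ n C)
    where
    image∉C : ∀ x → x ∈ image ι Z → x ∉ C
    image∉C x x∈image x∈C with ∈-image⁻ ι Z x∈image
    ... | j , refl = ι∉R j (x∈p∪q⁺ (inj₂ x∈C))
    ∣image∪C∣ : ∣ image ι Z ∪ C ∣ ≡ ∣ Z ∣ + ∣ C ∣
    ∣image∪C∣ = trans (∣p∪q∣≡∣p∣+∣q∣ image∉C) (cong (_+ ∣ C ∣) (∣image∣ ι injective Z))

  n≡k+d+c : n ≡ k + (∣ D ∣ + ∣ C ∣)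
  n≡k+d+c = begin
    n                        ≡⟨ sym (m∸n+n≡m (∣p∣≤n R)) ⟩
    (n ∸ ∣ R ∣) + ∣ R ∣       ≡⟨ cong₂ _+_ (sym k≡n∸∣R∣) (∣p∪q∣≡∣p∣+∣q∣ disjoint) ⟩
    k + (∣ D ∣ + ∣ C ∣)       ∎
    where
    open ≡-Reasoning
    image⊤≡∁R : image ι ⊤ ≡ ∁ R
    image⊤≡∁R = ⊆-antisym
      (λ x∈image → let (j , ιj≡x) = ∈-image⁻ ι ⊤ x∈image in x∉p⇒x∈∁p (subst (_∉ R) ιj≡x (ι∉R j)))
      (λ x∈∁R → let (j , ιj≡x) = Equivalence.to (proj₂ labelling _) (x∈∁p⇒x∉p x∈∁R)
                in subst (_∈ image ι ⊤) ιj≡x (∈-image⁺ ι ⊤ ∈⊤))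
    k≡n∸∣R∣ : k ≡ n ∸ ∣ R ∣
    k≡n∸∣R∣ = trans (sym (∣⊤∣≡n k)) (trans (sym (∣image∣ ι injective ⊤))
                (trans (cong ∣_∣ image⊤≡∁R) (∣∁p∣≡n∸∣p∣ R)))

  minor-inPU24 : Nonempty R → InPU24 k (minorRank (S n) C ι)
  minor-inPU24 (x , x∈R) =
    is2Polymatroid ,
    Equivalence.from (natBinary⇔binaryNatural r (IsPolymatroid.empty (proj₁ is2Polymatroid)))
      (minor-binaryNatural {d = ∣ D ∣} r minorRank-S n≡k+d+c (subst (0 <_) (∣p∪q∣≡∣p∣+∣q∣ disjoint) 0<∣R∣))
    where
    r = minorRank (S n) C ι
    is2Polymatroid : Is2Polymatroid k r
    is2Polymatroid = minor-is2Polymatroid r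
      (subst (k + ∣ C ∣ ≤_) (sym n≡k+d+c) (+-monoʳ-≤ k (m≤n+m ∣ C ∣ ∣ D ∣))) minorRank-S
    0<∣R∣ : 0 < ∣ R ∣
    0<∣R∣ = ≤-trans (≤-reflexive (sym (∣⁅x⁆∣≡1 x)))
      (p⊆q⇒∣p∣≤∣q∣ (λ y∈⁅x⁆ → subst (_∈ R) (sym (x∈⁅y⁆⇒x≡y x y∈⁅x⁆)) x∈R))

proposition5p5 : (n : ℕ) → 2 ≤ n → ExcludedMinorPU24 n (S n)
proposition5p5 (suc zero) (s≤s ())
proposition5p5 (suc (suc n′)) _ =
  S-isPolymatroid _ , S-notInPU24 n′ ,
  λ D C disjoint nonempty k ι labelling → LabelledMinor.minor-inPU24 D C disjoint ι labelling nonempty
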